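{- Let $G$ be a graph and let $\overrightarrow{G}$ be an oriented graph obtained by orienting each edge of $G$. Then there exists an edge-colouring of $G$, giving an edge-coloured graph $G^c$, such that (i) $\Delta_{\mathrm{mon}}(G^c)=\Delta^-(\overrightarrow{G})$; (ii) $d^c_{G^c}(v)=d^+_{\overrightarrow{G}}(v)+\min\{1,d^-_{\overrightarrow{G}}(v)\}$ for all $v\in V(G)$; (iii) $C$ is a properly coloured cycle in $G^c$ if and only if $C$ is a directed cycle in $\overrightarrow{G}$.
   Context: For an edge-coloured graph $H$, $\Delta_{\mathrm{mon}}(H)$ is the maximum, over vertices $v$ and colours $a$, of the number of edges of colour $a$ incident with $v$; $d^c_H(v)$ is the number of distinct colours on edges incident with $v$. A cycle is properly coloured if no two adjacent edges have the same colour. For an oriented graph $\overrightarrow{G}$, $d^-_{\overrightarrow{G}}(v)$ and $d^+_{\overrightarrow{G}}(v)$ are the in- and outdegree of $v$, and $\Delta^-(\overrightarrow{G})$ is the maximum indegree. -}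

module Defs where

open import Data.Bool using (Bool; true; false; if_then_else_)
open import Data.Nat using (ℕ; zero; suc; _⊔_; _⊓_; _%_; _≤_)
open import Data.Nat.DivMod using (m%n<n)
import Data.Nat as ℕ
open import Data.Fin using (Fin; toℕ; fromℕ<)
open import Data.List using (List; []; _∷_; length; map; foldr; allFin; filterᵇ; deduplicate)
open import Data.Product using (_×_; Σ)
open import Data.Sum using (_⊎_)
open import Function.Definitions using (Injective)
open import Relation.Binary.PropositionalEquality using (_≡_; _≢_)

record Graph (n : ℕ) : Set where
  field
    adj     : Fin n → Fin n → Bool
    irrefl  : ∀ v → adj v v ≡ false
    sym     : ∀ u v → adj u v ≡ true → adj v u ≡ true
open Graph public

record Orientation {n : ℕ} (G : Graph n) : Set where
  field
    arc        : Fin n → Fin n → Bool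
    arc⇒edge   : ∀ u v → arc u v ≡ true → adj G u v ≡ true
    edge⇒arc   : ∀ u v → adj G u v ≡ true → (arc u v ≡ true) ⊎ (arc v u ≡ true)
    antisym    : ∀ u v → arc u v ≡ true → arc v u ≡ false
open Orientation public

count : ∀ {A : Set} → (A → Bool) → List A → ℕ
count p []       = 0
count p (x ∷ xs) = if p x then suc (count p xs) else count p xs

maxList : List ℕ → ℕ
maxList = foldr _⊔_ 0

indeg : ∀ {n} {G : Graph n} → Orientation G → Fin n → ℕ
indeg {n} D v = count (λ u → arc D u v) (allFin n)

outdeg : ∀ {n} {G : Graph n} → Orientation G → Fin n → ℕ
outdeg {n} D v = count (λ u → arc D v u) (allFin n)

Δ⁻ : ∀ {n} {G : Graph n} → Orientation G → ℕ
Δ⁻ {n} D = maxList (map (indeg D) (allFin n))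

-- An edge-colouring of G with colours in ℕ: a colour c u v for each ordered
-- pair, required to be symmetric on edges (values on non-edges are irrelevant).
IsEdgeColouring : ∀ {n} → Graph n → (Fin n → Fin n → ℕ) → Set
IsEdgeColouring G c = ∀ u v → adj G u v ≡ true → c u v ≡ c v u

nbrs : ∀ {n} → Graph n → Fin n → List (Fin n)
nbrs {n} G v = filterᵇ (adj G v) (allFin n)

monDeg : ∀ {n} → Graph n → (Fin n → Fin n → ℕ) → Fin n → ℕ → ℕ
monDeg G c v a = count (λ u → c v u ℕ.≡ᵇ a) (nbrs G v)

-- Δ_mon: maximum over vertices v and colours a of monDeg v a.  Colours not
-- occurring at v contribute 0, so it suffices to range over colours a = c v u
-- of edges vu at v (0 if there are no edges).
Δmon : ∀ {n} → Graph n → (Fin n → Fin n → ℕ) → ℕ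
Δmon {n} G c =
  maxList (map (λ v → maxList (map (λ u → monDeg G c v (c v u)) (nbrs G v))) (allFin n))

colourDeg : ∀ {n} → Graph n → (Fin n → Fin n → ℕ) → Fin n → ℕ
colourDeg G c v = length (deduplicate ℕ._≟_ (map (c v) (nbrs G v)))

csuc : ∀ {k} → Fin (suc k) → Fin (suc k)
csuc {k} i = fromℕ< (m%n<n (suc (toℕ i)) (suc k))

record Cycle {n : ℕ} (G : Graph n) : Set where
  field
    len     : ℕ            -- the cycle has length len + 3
    vtx     : Fin (suc (suc (suc len))) → Fin n
    inj     : Injective _≡_ _≡_ vtx
    edges   : ∀ i → adj G (vtx i) (vtx (csuc i)) ≡ true
open Cycle public

ProperlyColoured : ∀ {n} {G : Graph n} → (Fin n → Fin n → ℕ) → Cycle G → Set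
ProperlyColoured c C =
  ∀ i → c (vtx C i) (vtx C (csuc i)) ≢ c (vtx C (csuc i)) (vtx C (csuc (csuc i)))

DirectedCycle : ∀ {n} {G : Graph n} → Orientation G → Cycle G → Set
DirectedCycle D C =
  (∀ i → arc D (vtx C i) (vtx C (csuc i)) ≡ true)
  ⊎ (∀ i → arc D (vtx C (csuc i)) (vtx C i) ≡ true)

module Submission where

-- Colour every edge of G by its head in the orientation D: the arc u → v
-- gets colour v (as a natural number).  Then
--  * the edges of colour v at v are exactly the arcs into v, while an
--    out-neighbour u of v colours only the single edge vu at v; hence the
--    largest colour class is the largest indegree, Δmon = Δ⁻;
--  * the colours at v are v itself (present iff v has an in-neighbour)
--    together with the out-neighbours of v, all distinct, so the colour
--    degree is outdeg v + min(1, indeg v);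
--  * along a cycle, two consecutive edges x₀x₁, x₁x₂ have equal colours exactly
--    when both point towards x₁; so in a properly coloured cycle every edge
--    oriented along the traversal is followed by another such edge, and going
--    round the cycle it is directed.  Conversely, consecutive edges of a
--    directed cycle have distinct heads.

open import Defs hiding (sym)
open import Data.Nat using (ℕ; _+_; _⊓_)
open import Data.Product using (Σ; _×_)
open import Function.Bundles using (_⇔_)
open import Relation.Binary.PropositionalEquality using (_≡_)
open import Data.Fin using (Fin)

open import Data.Bool using (Bool; true; false; _∧_; if_then_else_)
open import Data.Bool.Properties using (T-≡; ¬-not; not-¬)
open import Data.Empty using (⊥-elim)
open import Data.Nat using (zero; suc; _≤_; _∸_; _%_; _≡ᵇ_; _≟_; _≤?_; z≤n; s≤s)
open import Data.Nat.Properties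
open import Data.Nat.DivMod using (m<n⇒m%n≡m; n%n≡0; %-distribˡ-+; m%n%n≡m%n; [m+n]%n≡m%n)
open import Data.Fin using (toℕ)
open import Data.Fin.Properties using (toℕ-injective; toℕ-fromℕ<; toℕ<n)
open import Data.List using (List; []; _∷_; [_]; _++_; length; map; allFin; filterᵇ; deduplicate)
open import Data.List.Properties using (length-map)
open import Data.List.Membership.Propositional using (_∈_)
open import Data.List.Membership.Propositional.Properties using (∈-allFin; ∈-map⁺; ∈-map⁻; ∈-++⁺ˡ; ∈-++⁺ʳ; ∈-++⁻; ∈-filter⁺; ∈-filter⁻; deduplicate-∈⇔)
open import Data.List.Membership.Propositional.Properties.WithK using (unique∧set⇒bag)
open import Data.List.Relation.Binary.BagAndSetEquality using (∼bag⇒↭)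
open import Data.List.Relation.Binary.Permutation.Propositional.Properties using (↭-length)
open import Data.List.Relation.Unary.Any using (here; there)
open import Data.List.Relation.Unary.All using (All; []; _∷_)
import Data.List.Relation.Unary.All as All
open import Data.List.Relation.Unary.Unique.Propositional using (Unique; []; _∷_)
import Data.List.Relation.Unary.Unique.Propositional.Properties as Unique
open import Data.List.Relation.Unary.Unique.DecPropositional.Properties _≟_ using (deduplicate-!)
open import Data.Product using (∃; _,_; proj₂)
import Data.Product as Product
open import Data.Sum using (inj₁; inj₂)
open import Function using (_∘_)
open import Function.Bundles using (mk⇔; Equivalence)
open import Relation.Nullary using (yes; no)
open import Relation.Nullary.Decidable using (T?)
open import Relation.Binary.PropositionalEquality using (_≢_; refl; sym; trans; cong; cong₂; subst; module ≡-Reasoning)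

module _ {A : Set} where

  count-filterᵇ : (p r : A → Bool) (xs : List A) →
    count p (filterᵇ r xs) ≡ count (λ x → r x ∧ p x) xs
  count-filterᵇ p r [] = refl
  count-filterᵇ p r (x ∷ xs) with r x
  ... | false = count-filterᵇ p r xs
  ... | true with p x
  ...   | true  = cong suc (count-filterᵇ p r xs)
  ...   | false = count-filterᵇ p r xs

  length-filterᵇ : (p : A → Bool) (xs : List A) → length (filterᵇ p xs) ≡ count p xs
  length-filterᵇ p [] = refl
  length-filterᵇ p (x ∷ xs) with p x
  ... | true  = cong suc (length-filterᵇ p xs)
  ... | false = length-filterᵇ p xs

  count-cong : {p q : A → Bool} → (∀ x → p x ≡ q x) → (xs : List A) → count p xs ≡ count q xs
  count-cong p≗q [] = refl
  count-cong p≗q (x ∷ xs) rewrite p≗q x | count-cong p≗q xs = refl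

  count-mono : {p q : A → Bool} → (∀ x → p x ≡ true → q x ≡ true) →
    (xs : List A) → count p xs ≤ count q xs
  count-mono p⇒q [] = z≤n
  count-mono {p} {q} p⇒q (x ∷ xs) with p x in px | q x in qx
  ... | true  | true  = s≤s (count-mono p⇒q xs)
  ... | true  | false = ⊥-elim (not-¬ (p⇒q x px) qx)
  ... | false | true  = m≤n⇒m≤1+n (count-mono p⇒q xs)
  ... | false | false = count-mono p⇒q xs

  count-witness : (p : A → Bool) (xs : List A) → 1 ≤ count p xs → ∃ λ x → x ∈ xs × p x ≡ true
  count-witness p (x ∷ xs) pos with p x in px
  ... | true  = x , here refl , px
  ... | false = Product.map₂ (Product.map₁ there) (count-witness p xs pos)

  count-≥1 : (p : A → Bool) {x : A} {xs : List A} → x ∈ xs → p x ≡ true → 1 ≤ count p xs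
  count-≥1 p (here refl) px rewrite px = s≤s z≤n
  count-≥1 p {xs = y ∷ _} (there x∈xs) px with p y
  ... | true  = s≤s z≤n
  ... | false = count-≥1 p x∈xs px

  count-none : (p : A → Bool) {xs : List A} → All (λ x → p x ≡ false) xs → count p xs ≡ 0
  count-none p [] = refl
  count-none p (px ∷ pxs) rewrite px = count-none p pxs

  count-≤1 : (p : A → Bool) → (∀ x y → p x ≡ true → p y ≡ true → x ≡ y) →
    {xs : List A} → Unique xs → count p xs ≤ 1
  count-≤1 p single [] = z≤n
  count-≤1 p single {x ∷ _} (x∉xs ∷ uniq) with p x in px
  ... | false = count-≤1 p single uniq
  ... | true  = s≤s (≤-reflexive (count-none p (All.map (λ x≢y → ¬-not (x≢y ∘ single _ _ px)) x∉xs)))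

  maxList-lub : (f : A → ℕ) {m : ℕ} (xs : List A) → (∀ {x} → x ∈ xs → f x ≤ m) →
    maxList (map f xs) ≤ m
  maxList-lub f [] bound = z≤n
  maxList-lub f (x ∷ xs) bound = ⊔-lub (bound (here refl)) (maxList-lub f xs (bound ∘ there))

  maxList-ub : (f : A → ℕ) {x : A} {xs : List A} → x ∈ xs → f x ≤ maxList (map f xs)
  maxList-ub f {xs = y ∷ _} (here refl) = m≤m⊔n (f y) _
  maxList-ub f {xs = y ∷ _} (there x∈xs) = ≤-trans (maxList-ub f x∈xs) (m≤n⊔m (f y) _)

  ∈-filterᵇ⁺ : (p : A → Bool) {x : A} {xs : List A} → x ∈ xs → p x ≡ true → x ∈ filterᵇ p xs
  ∈-filterᵇ⁺ p x∈xs px = ∈-filter⁺ (T? ∘ p) x∈xs (Equivalence.from T-≡ px)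

  ∈-filterᵇ⁻ : (p : A → Bool) {x : A} {xs : List A} → x ∈ filterᵇ p xs → x ∈ xs × p x ≡ true
  ∈-filterᵇ⁻ p x∈ = Product.map₂ (Equivalence.to T-≡) (∈-filter⁻ (T? ∘ p) x∈)

  unique-set-length : {xs ys : List A} → Unique xs → Unique ys →
    (∀ {z} → z ∈ xs ⇔ z ∈ ys) → length xs ≡ length ys
  unique-set-length uxs uys same = ↭-length (∼bag⇒↭ (unique∧set⇒bag uxs uys same))

  -- `whenPositive k x` is [ x ] if k is positive and [] otherwise; it lists
  -- the colour a vertex sees on its in-edges.
  whenPositive : ℕ → A → List A
  whenPositive zero    x = []
  whenPositive (suc _) x = [ x ]

  ∈-whenPositive⁺ : {k : ℕ} {x : A} → 1 ≤ k → x ∈ whenPositive k x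
  ∈-whenPositive⁺ {suc _} _ = here refl

  ∈-whenPositive⁻ : {k : ℕ} {x z : A} → z ∈ whenPositive k x → z ≡ x × 1 ≤ k
  ∈-whenPositive⁻ {suc _} (here z≡x) = z≡x , s≤s z≤n

  unique-whenPositive++ : (k : ℕ) {x : A} {ys : List A} →
    All (x ≢_) ys → Unique ys → Unique (whenPositive k x ++ ys)
  unique-whenPositive++ zero    x∉ys uys = uys
  unique-whenPositive++ (suc _) x∉ys uys = x∉ys ∷ uys

  length-whenPositive++ : (k : ℕ) {x : A} (ys : List A) →
    length (whenPositive k x ++ ys) ≡ length ys + (1 ⊓ k)
  length-whenPositive++ zero    ys = sym (+-identityʳ (length ys))
  length-whenPositive++ (suc _) ys = +-comm 1 (length ys)

≡ᵇ-complete : {m n : ℕ} → m ≡ n → (m ≡ᵇ n) ≡ true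
≡ᵇ-complete {m} {n} m≡n = Equivalence.to T-≡ (≡⇒≡ᵇ m n m≡n)

≡ᵇ-sound : {m n : ℕ} → (m ≡ᵇ n) ≡ true → m ≡ n
≡ᵇ-sound {m} {n} m≡ᵇn = ≡ᵇ⇒≡ m n (Equivalence.from T-≡ m≡ᵇn)

≡ᵇ-distinct : {m n : ℕ} → m ≢ n → (m ≡ᵇ n) ≡ false
≡ᵇ-distinct m≢n = ¬-not (m≢n ∘ ≡ᵇ-sound)

toℕ-csuc : {k : ℕ} (i : Fin (suc k)) → toℕ (csuc i) ≡ suc (toℕ i) % suc k
toℕ-csuc i = toℕ-fromℕ< _

csuc≢ : {k : ℕ} (i : Fin (suc (suc k))) → csuc i ≢ i
csuc≢ {k} i csuc-i≡i with suc (toℕ i) ≤? suc k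
... | yes notLast = 1+n≢n (begin
  suc (toℕ i)             ≡⟨ sym (m<n⇒m%n≡m (s≤s notLast)) ⟩
  suc (toℕ i) % suc (suc k) ≡⟨ sym (toℕ-csuc i) ⟩
  toℕ (csuc i)            ≡⟨ cong toℕ csuc-i≡i ⟩
  toℕ i                   ∎)
  where open ≡-Reasoning
... | no last = 1+n≢0 (begin
  suc k        ≡⟨ suc-injective i+1≡N ⟨
  toℕ i        ≡⟨ cong toℕ csuc-i≡i ⟨
  toℕ (csuc i) ≡⟨ toℕ-csuc i ⟩
  suc (toℕ i) % suc (suc k) ≡⟨ cong (_% suc (suc k)) i+1≡N ⟩
  suc (suc k) % suc (suc k) ≡⟨ n%n≡0 (suc (suc k)) ⟩
  0            ∎)
  where
  open ≡-Reasoning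
  i+1≡N : suc (toℕ i) ≡ suc (suc k)
  i+1≡N = ≤-antisym (toℕ<n i) (≰⇒> last)

csuc^ : {k : ℕ} → ℕ → Fin (suc k) → Fin (suc k)
csuc^ zero    i = i
csuc^ (suc m) i = csuc (csuc^ m i)

toℕ-csuc^ : {k : ℕ} (m : ℕ) (i : Fin (suc k)) → toℕ (csuc^ m i) ≡ (toℕ i + m) % suc k
toℕ-csuc^ {k} zero i = begin
  toℕ i           ≡⟨ m<n⇒m%n≡m (toℕ<n i) ⟨
  toℕ i % suc k   ≡⟨ cong (_% suc k) (+-identityʳ (toℕ i)) ⟨
  (toℕ i + 0) % suc k ∎
  where open ≡-Reasoning
toℕ-csuc^ {k} (suc m) i = begin
  toℕ (csuc (csuc^ m i))      ≡⟨ toℕ-csuc (csuc^ m i) ⟩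
  (1 + toℕ (csuc^ m i)) % N   ≡⟨ cong (λ z → (1 + z) % N) (toℕ-csuc^ m i) ⟩
  (1 + a % N) % N             ≡⟨ %-distribˡ-+ 1 (a % N) N ⟩
  (1 % N + a % N % N) % N     ≡⟨ cong (λ z → (1 % N + z) % N) (m%n%n≡m%n a N) ⟩
  (1 % N + a % N) % N         ≡⟨ %-distribˡ-+ 1 a N ⟨
  (1 + a) % N                 ≡⟨ cong (_% N) (+-suc (toℕ i) m) ⟨
  (toℕ i + suc m) % N         ∎
  where
  open ≡-Reasoning
  N = suc k
  a = toℕ i + m

csuc^-reaches : {k : ℕ} (i j : Fin (suc k)) → csuc^ (suc k ∸ toℕ i + toℕ j) i ≡ j
csuc^-reaches {k} i j = toℕ-injective (begin
  toℕ (csuc^ (N ∸ t + toℕ j) i) ≡⟨ toℕ-csuc^ (N ∸ t + toℕ j) i ⟩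
  (t + (N ∸ t + toℕ j)) % N     ≡⟨ cong (_% N) (+-assoc t (N ∸ t) (toℕ j)) ⟨
  (t + (N ∸ t) + toℕ j) % N     ≡⟨ cong (λ z → (z + toℕ j) % N) (m+[n∸m]≡n (<⇒≤ (toℕ<n i))) ⟩
  (N + toℕ j) % N               ≡⟨ cong (_% N) (+-comm N (toℕ j)) ⟩
  (toℕ j + N) % N               ≡⟨ [m+n]%n≡m%n (toℕ j) N ⟩
  toℕ j % N                     ≡⟨ m<n⇒m%n≡m (toℕ<n j) ⟩
  toℕ j                         ∎)
  where
  open ≡-Reasoning
  N = suc k
  t = toℕ i

csuc-invariant : {k : ℕ} (P : Fin (suc k) → Set) → (∀ i → P i → P (csuc i)) →
  {i : Fin (suc k)} → P i → ∀ j → P j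
csuc-invariant {k} P step {i} Pi j = subst P (csuc^-reaches i j) (along (suc k ∸ toℕ i + toℕ j))
  where
  along : ∀ m → P (csuc^ m i)
  along zero    = Pi
  along (suc m) = step (csuc^ m i) (along m)

module _ {n : ℕ} {G : Graph n} where

  adj⇒≢ : ∀ {u v} → adj G u v ≡ true → u ≢ v
  adj⇒≢ {u} uv refl = not-¬ uv (irrefl G u)

  module _ (D : Orientation G) where

    arc-reverse : ∀ {u v} → adj G u v ≡ true → arc D u v ≡ false → arc D v u ≡ true
    arc-reverse {u} {v} uv not-u→v with edge⇒arc D u v uv
    ... | inj₁ u→v = ⊥-elim (not-¬ u→v not-u→v)
    ... | inj₂ v→u = v→u

    arc⇒reverse-edge : ∀ {u v} → arc D u v ≡ true → adj G v u ≡ true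
    arc⇒reverse-edge {u} {v} u→v = Graph.sym G u v (arc⇒edge D u v u→v)

    headColour : Fin n → Fin n → ℕ
    headColour u v = if arc D u v then toℕ v else toℕ u

    colour-forward : ∀ {u v} → arc D u v ≡ true → headColour u v ≡ toℕ v
    colour-forward u→v rewrite u→v = refl

    colour-backward : ∀ {u v} → arc D v u ≡ true → headColour u v ≡ toℕ u
    colour-backward {u} {v} v→u rewrite antisym D v u v→u = refl

    headColour-isEdgeColouring : IsEdgeColouring G headColour
    headColour-isEdgeColouring u v uv with edge⇒arc D u v uv
    ... | inj₁ u→v = trans (colour-forward u→v) (sym (colour-backward u→v))
    ... | inj₂ v→u = trans (colour-backward v→u) (sym (colour-forward v→u))

    private
      c = headColour

    monDeg-head : ∀ v → monDeg G c v (toℕ v) ≡ indeg D v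
    monDeg-head v = trans (count-filterᵇ _ (adj G v) (allFin n)) (count-cong inArc (allFin n))
      where
      inArc : ∀ w → (adj G v w ∧ (c v w ≡ᵇ toℕ v)) ≡ arc D w v
      inArc w with arc D w v in w→v
      ... | true = cong₂ _∧_ (arc⇒reverse-edge w→v) (≡ᵇ-complete (colour-backward w→v))
      ... | false with adj G v w in vw
      ...   | false = refl
      ...   | true  = trans (cong (_≡ᵇ toℕ v) (colour-forward (arc-reverse (Graph.sym G v w vw) w→v)))
                            (≡ᵇ-distinct (adj⇒≢ (Graph.sym G v w vw) ∘ toℕ-injective))

    monDeg-tail : ∀ {v u} → arc D v u ≡ true → monDeg G c v (toℕ u) ≤ 1
    monDeg-tail {v} {u} v→u = begin
      monDeg G c v (toℕ u)                                ≡⟨ count-filterᵇ _ (adj G v) (allFin n) ⟩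
      count (λ w → adj G v w ∧ (c v w ≡ᵇ toℕ u)) (allFin n) ≤⟨ count-mono onlyU (allFin n) ⟩
      count (λ w → toℕ w ≡ᵇ toℕ u) (allFin n)             ≤⟨ count-≤1 _ sameNumber (Unique.allFin⁺ n) ⟩
      1                                                   ∎
      where
      open ≤-Reasoning
      sameNumber : ∀ x y → (toℕ x ≡ᵇ toℕ u) ≡ true → (toℕ y ≡ᵇ toℕ u) ≡ true → x ≡ y
      sameNumber x y x≡u y≡u = toℕ-injective (trans (≡ᵇ-sound x≡u) (sym (≡ᵇ-sound y≡u)))
      onlyU : ∀ w → (adj G v w ∧ (c v w ≡ᵇ toℕ u)) ≡ true → (toℕ w ≡ᵇ toℕ u) ≡ true
      onlyU w colour≡u with adj G v w in vw
      ... | true with edge⇒arc D v w vw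
      ...   | inj₁ v→w = trans (cong (_≡ᵇ toℕ u) (sym (colour-forward v→w))) colour≡u
      ...   | inj₂ w→v = ⊥-elim (adj⇒≢ (arc⇒edge D v u v→u)
                (toℕ-injective (≡ᵇ-sound (trans (cong (_≡ᵇ toℕ u) (sym (colour-backward w→v))) colour≡u))))

    Δ⁻-ub : ∀ v → indeg D v ≤ Δ⁻ D
    Δ⁻-ub v = maxList-ub (indeg D) (∈-allFin v)

    -- Every colour class at a vertex has at most Δ⁻ edges: a class of an
    -- in-colour is an in-star, a class of an out-colour is a single edge.
    monDeg≤Δ⁻ : ∀ {v u} → adj G v u ≡ true → monDeg G c v (c v u) ≤ Δ⁻ D
    monDeg≤Δ⁻ {v} {u} vu with edge⇒arc D v u vu
    ... | inj₁ v→u = begin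
      monDeg G c v (c v u)  ≡⟨ cong (monDeg G c v) (colour-forward v→u) ⟩
      monDeg G c v (toℕ u)  ≤⟨ monDeg-tail v→u ⟩
      1                     ≤⟨ count-≥1 (λ w → arc D w u) (∈-allFin v) v→u ⟩
      indeg D u             ≤⟨ Δ⁻-ub u ⟩
      Δ⁻ D                  ∎
      where open ≤-Reasoning
    ... | inj₂ u→v = begin
      monDeg G c v (c v u)  ≡⟨ cong (monDeg G c v) (colour-backward u→v) ⟩
      monDeg G c v (toℕ v)  ≡⟨ monDeg-head v ⟩
      indeg D v             ≤⟨ Δ⁻-ub v ⟩
      Δ⁻ D                  ∎
      where open ≤-Reasoning

    maxMonDegAt : Fin n → ℕ
    maxMonDegAt v = maxList (map (λ u → monDeg G c v (c v u)) (nbrs G v))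

    Δmon≤Δ⁻ : Δmon G c ≤ Δ⁻ D
    Δmon≤Δ⁻ = maxList-lub maxMonDegAt (allFin n) λ {v} _ →
      maxList-lub (λ u → monDeg G c v (c v u)) (nbrs G v) λ u∈nbrs →
        monDeg≤Δ⁻ (proj₂ (∈-filterᵇ⁻ (adj G v) {xs = allFin n} u∈nbrs))

    -- If v has an in-neighbour u, the in-star of v is the colour class of vu.
    indeg≤Δmon : ∀ v → indeg D v ≤ Δmon G c
    indeg≤Δmon v with 1 ≤? indeg D v
    ... | no noIn = subst (_≤ Δmon G c) (sym (n<1⇒n≡0 (≰⇒> noIn))) z≤n
    ... | yes someIn with count-witness (λ w → arc D w v) (allFin n) someIn
    ...   | u , _ , u→v = begin
      indeg D v            ≡⟨ monDeg-head v ⟨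
      monDeg G c v (toℕ v) ≡⟨ cong (monDeg G c v) (colour-backward u→v) ⟨
      monDeg G c v (c v u) ≤⟨ maxList-ub (λ u → monDeg G c v (c v u)) u∈nbrs ⟩
      maxMonDegAt v        ≤⟨ maxList-ub maxMonDegAt (∈-allFin v) ⟩
      Δmon G c             ∎
      where
      open ≤-Reasoning
      u∈nbrs : u ∈ nbrs G v
      u∈nbrs = ∈-filterᵇ⁺ (adj G v) (∈-allFin u) (arc⇒reverse-edge u→v)

    Δ⁻≤Δmon : Δ⁻ D ≤ Δmon G c
    Δ⁻≤Δmon = maxList-lub (indeg D) (allFin n) λ {v} _ → indeg≤Δmon v

    coloursAt : Fin n → List ℕ
    coloursAt v = map (c v) (nbrs G v)

    outNbrs : Fin n → List (Fin n)
    outNbrs v = filterᵇ (arc D v) (allFin n)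

    predictedColours : Fin n → List ℕ
    predictedColours v = whenPositive (indeg D v) (toℕ v) ++ map toℕ (outNbrs v)

    edgeColour∈coloursAt : ∀ {v u} → adj G v u ≡ true → c v u ∈ coloursAt v
    edgeColour∈coloursAt {v} {u} vu = ∈-map⁺ (c v) (∈-filterᵇ⁺ (adj G v) (∈-allFin u) vu)

    coloursAt⊆predicted : ∀ v {z} → z ∈ coloursAt v → z ∈ predictedColours v
    coloursAt⊆predicted v z∈ with ∈-map⁻ (c v) z∈
    ... | u , u∈nbrs , refl with edge⇒arc D v u (proj₂ (∈-filterᵇ⁻ (adj G v) {xs = allFin n} u∈nbrs))
    ...   | inj₁ v→u = subst (_∈ predictedColours v) (sym (colour-forward v→u))
              (∈-++⁺ʳ _ (∈-map⁺ toℕ (∈-filterᵇ⁺ (arc D v) (∈-allFin u) v→u)))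
    ...   | inj₂ u→v = subst (_∈ predictedColours v) (sym (colour-backward u→v))
              (∈-++⁺ˡ (∈-whenPositive⁺ (count-≥1 (λ w → arc D w v) (∈-allFin u) u→v)))

    predicted⊆coloursAt : ∀ v {z} → z ∈ predictedColours v → z ∈ coloursAt v
    predicted⊆coloursAt v z∈ with ∈-++⁻ (whenPositive (indeg D v) (toℕ v)) z∈
    ... | inj₁ z∈in with ∈-whenPositive⁻ z∈in
    ...   | refl , someIn with count-witness (λ w → arc D w v) (allFin n) someIn
    ...     | u , _ , u→v = subst (_∈ coloursAt v) (colour-backward u→v)
                (edgeColour∈coloursAt (arc⇒reverse-edge u→v))
    predicted⊆coloursAt v z∈ | inj₂ z∈out with ∈-map⁻ toℕ z∈out
    ... | u , u∈out , refl = subst (_∈ coloursAt v) (colour-forward v→u)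
            (edgeColour∈coloursAt (arc⇒edge D v u v→u))
      where
      v→u : arc D v u ≡ true
      v→u = proj₂ (∈-filterᵇ⁻ (arc D v) {xs = allFin n} u∈out)

    -- No out-neighbour is v itself, so the predicted colours are distinct.
    predictedColours-unique : ∀ v → Unique (predictedColours v)
    predictedColours-unique v = unique-whenPositive++ (indeg D v) (All.tabulate v∉out)
      (Unique.map⁺ toℕ-injective (Unique.filter⁺ (T? ∘ arc D v) (Unique.allFin⁺ n)))
      where
      v∉out : ∀ {z} → z ∈ map toℕ (outNbrs v) → toℕ v ≢ z
      v∉out z∈ with ∈-map⁻ toℕ z∈
      ... | u , u∈out , refl = adj⇒≢ (arc⇒edge D v u (proj₂ (∈-filterᵇ⁻ (arc D v) {xs = allFin n} u∈out)))
                                ∘ toℕ-injective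

    colourDeg-head : ∀ v → colourDeg G c v ≡ outdeg D v + (1 ⊓ indeg D v)
    colourDeg-head v = begin
      colourDeg G c v
        ≡⟨ unique-set-length (deduplicate-! (coloursAt v)) (predictedColours-unique v)
             (mk⇔ (coloursAt⊆predicted v ∘ Equivalence.from dedup)
                  (Equivalence.to dedup ∘ predicted⊆coloursAt v)) ⟩
      length (predictedColours v)
        ≡⟨ length-whenPositive++ (indeg D v) (map toℕ (outNbrs v)) ⟩
      length (map toℕ (outNbrs v)) + (1 ⊓ indeg D v)
        ≡⟨ cong (_+ (1 ⊓ indeg D v)) (trans (length-map toℕ (outNbrs v)) (length-filterᵇ (arc D v) (allFin n))) ⟩
      outdeg D v + (1 ⊓ indeg D v)
        ∎
      where
      open ≡-Reasoning
      dedup : ∀ {z} → z ∈ coloursAt v ⇔ z ∈ deduplicate _≟_ (coloursAt v)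
      dedup = deduplicate-∈⇔ _≟_

    module _ (C : Cycle G) where

      private
        x = vtx C

      Forward : Fin (suc (suc (suc (len C)))) → Set
      Forward i = arc D (x i) (x (csuc i)) ≡ true

      -- In a properly coloured cycle a forward edge is followed by a forward
      -- edge: otherwise both edges would be coloured by their common vertex.
      forward-step : ProperlyColoured c C → ∀ i → Forward i → Forward (csuc i)
      forward-step proper i fwd with edge⇒arc D (x (csuc i)) (x (csuc (csuc i))) (edges C (csuc i))
      ... | inj₁ next-fwd = next-fwd
      ... | inj₂ next-bwd = ⊥-elim (proper i (trans (colour-forward fwd) (sym (colour-backward next-bwd))))

      properly⇒directed : ProperlyColoured c C → DirectedCycle D C
      properly⇒directed proper with arc D (x Fin.zero) (x (csuc Fin.zero)) in first
      ... | true  = inj₁ (csuc-invariant Forward (forward-step proper) first)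
      ... | false = inj₂ λ j → arc-reverse (edges C j) (backward j)
        where
        backward : ∀ j → arc D (x j) (x (csuc j)) ≡ false
        backward j = ¬-not λ fwd →
          not-¬ (csuc-invariant Forward (forward-step proper) fwd Fin.zero) first

      -- Consecutive edges of a directed cycle have distinct heads.
      directed⇒properly : DirectedCycle D C → ProperlyColoured c C
      directed⇒properly (inj₁ fwd) i same = csuc≢ (csuc i) (sym (inj C (toℕ-injective
        (trans (sym (colour-forward (fwd i))) (trans same (colour-forward (fwd (csuc i))))))))
      directed⇒properly (inj₂ bwd) i same = csuc≢ i (sym (inj C (toℕ-injective
        (trans (sym (colour-backward (bwd i))) (trans same (colour-backward (bwd (csuc i))))))))

proposition2p2 : ∀ {n} (G : Graph n) (D : Orientation G) →
    Σ (Fin n → Fin n → ℕ) λ c →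
      IsEdgeColouring G c
      × Δmon G c ≡ Δ⁻ D
      × (∀ v → colourDeg G c v ≡ outdeg D v + (1 ⊓ indeg D v))
      × (∀ (C : Cycle G) → ProperlyColoured c C ⇔ DirectedCycle D C)
proposition2p2 G D =
  headColour D ,
  headColour-isEdgeColouring D ,
  ≤-antisym (Δmon≤Δ⁻ D) (Δ⁻≤Δmon D) ,
  colourDeg-head D ,
  λ C → mk⇔ (properly⇒directed D C) (directed⇒properly D C)
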